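{- Let $M$ be a binary matrix (no all-zero rows) without duplicated columns, let $B$ be a branching of its containment digraph $D_M$, and let $M^B$ be the $B$-split of $M$. Then $M^B$ is a conflict-free row split of $M$ with $|U(B)|$ rows, in which each row $r_i$ of $M$ is split into the rows of $M^B$ indexed by $U_B(r_i)$ (i.e. $r_i$ is the bitwise OR of those rows). Moreover, the number of distinct rows of $M^B$ is $|I(B)|$.
   Context: A binary matrix is conflict-free if there are no two columns $i,j$ and three distinct rows $r,r',r''$ with $(M_{r,i},M_{r,j})=(1,1)$, $(M_{r',i},M_{r',j})=(1,0)$, $(M_{r'',i},M_{r'',j})=(0,1)$. A row split of $M$ (rows $r_1,\dots,r_m$) is a binary matrix with the same number of columns whose rows can be partitioned into $R_1,\dots,R_m$ with $r_i$ the bitwise OR of $R_i$. Let $M$ have columns $c_1,\dots,c_n$ and $v_j=\mathrm{supp}_M(c_j)$ (the set of rows with a $1$ in column $c_j$). The containment digraph $D_M$ has vertex set $V=\{v_1,\dots,v_n\}$ and arcs $(v,v')$ whenever $v\subsetneq v'$. A branching is a set $B$ of arcs of $D_M$ with every vertex having at most one outgoing arc in $B$. A row $r\in v$ is covered in $v$ if $r\in v'$ for some arc $(v',v)\in B$, otherwise uncovered. $U(B)$ is the set of pairs $(r,v)$ with $v\in V$, $r\in v$, $r$ uncovered in $v$; $U_B(r)$ is the set of pairs in $U(B)$ with first coordinate $r$. $I(B)$ is the set of vertices $v$ containing some uncovered element. For $v\in V$, $B^+(v)$ is the set of vertices reachable from $v$ by a directed path in $(V,B)$ (including $v$). The $B$-split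 $M^B$ is the matrix with rows indexed by $U(B)$ and columns $c'_1,\dots,c'_n$, with $M^B_{(r,v),j}=1$ if $v_j\in B^+(v)$ and $0$ otherwise. -}

module Defs where

open import Data.Bool using (Bool; true; false; _∨_)
import Data.Bool.Properties as BoolP
open import Data.Nat using (ℕ; zero; suc)
open import Data.Fin using (Fin; _≟_)
open import Data.Fin.Properties using (any?)
open import Data.Maybe using (Maybe; just; nothing)
import Data.Maybe.Properties as MaybeP
open import Data.Product using (Σ; ∃; _×_; _,_; proj₁; proj₂)
open import Data.List using (List; length; filter; map; cartesianProduct; deduplicate; lookup; allFin)
open import Data.Vec using (Vec; tabulate)
import Data.Vec.Properties as VecP
open import Function.Bundles using (_⇔_)
open import Relation.Nullary using (¬_; Dec; yes; no; _×-dec_; ¬?)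
open import Relation.Nullary.Decidable using (⌊_⌋)
open import Relation.Binary.PropositionalEquality using (_≡_; _≢_)

Mat : ℕ → ℕ → Set
Mat m n = Fin m → Fin n → Bool

NoZeroRows : ∀ {m n} → Mat m n → Set
NoZeroRows M = ∀ r → ∃ λ j → M r j ≡ true

NoDupCols : ∀ {m n} → Mat m n → Set
NoDupCols M = ∀ i j → (∀ r → M r i ≡ M r j) → i ≡ j

ConflictFree : ∀ {k n} → Mat k n → Set
ConflictFree N = ∀ i j r r' r'' → r ≢ r' → r ≢ r'' → r' ≢ r'' →
  ¬ ((N r i ≡ true × N r j ≡ true) ×
     (N r' i ≡ true × N r' j ≡ false) ×
     (N r'' i ≡ false × N r'' j ≡ true))

-- N (k rows) is a row split of M (m rows) w.r.t. the partition of the rows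
-- of N given by f (block R_i = f⁻¹(i)): row i of M is the bitwise OR of the rows of R_i.
IsRowSplitVia : ∀ {m k n} → Mat m n → Mat k n → (Fin k → Fin m) → Set
IsRowSplitVia M N f = ∀ i j → (M i j ≡ true ⇔ (∃ λ l → f l ≡ i × N l j ≡ true))

IsRowSplit : ∀ {m k n} → Mat m n → Mat k n → Set
IsRowSplit {k = k} M N = Σ (Fin k → _) λ f → IsRowSplitVia M N f

-- Vertices of D_M are identified with column indices (columns are distinct,
-- so v_j = supp(c_j) are distinct). Strict containment supp(c_i) ⊊ supp(c_j):
StrictSub : ∀ {m n} → Mat m n → Fin n → Fin n → Set
StrictSub M i j = (∀ r → M r i ≡ true → M r j ≡ true) × (∃ λ r → M r j ≡ true × M r i ≡ false)

-- A set of arcs with out-degree ≤ 1 at every vertex, given as a partial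
-- "out-neighbour" function.
Branching : ℕ → Set
Branching n = Fin n → Maybe (Fin n)

IsBranching : ∀ {m n} → Mat m n → Branching n → Set
IsBranching M B = ∀ i j → B i ≡ just j → StrictSub M i j

Covered : ∀ {m n} → Mat m n → Branching n → Fin m → Fin n → Set
Covered M B r j = ∃ λ i → B i ≡ just j × M r i ≡ true

covered? : ∀ {m n} (M : Mat m n) (B : Branching n) r j → Dec (Covered M B r j)
covered? M B r j = any? λ i → MaybeP.≡-dec _≟_ (B i) (just j) ×-dec (M r i BoolP.≟ true)

Uncov : ∀ {m n} → Mat m n → Branching n → Fin m × Fin n → Set
Uncov M B (r , j) = M r j ≡ true × ¬ Covered M B r j

uncov? : ∀ {m n} (M : Mat m n) (B : Branching n) p → Dec (Uncov M B p)
uncov? M B (r , j) = (M r j BoolP.≟ true) ×-dec ¬? (covered? M B r j)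

-- U(B), as a duplicate-free list of pairs
U : ∀ {m n} → Mat m n → Branching n → List (Fin m × Fin n)
U {m} {n} M B = filter (uncov? M B) (cartesianProduct (allFin m) (allFin n))

I : ∀ {m n} → Mat m n → Branching n → List (Fin n)
I {m} {n} M B = filter (λ j → any? λ r → uncov? M B (r , j)) (allFin n)

reachWithin : ∀ {n} → Branching n → ℕ → Fin n → Fin n → Bool
reachWithin B zero v w = ⌊ v ≟ w ⌋
reachWithin B (suc k) v w with B v
... | nothing = ⌊ v ≟ w ⌋
... | just u  = ⌊ v ≟ w ⌋ ∨ reachWithin B k u w

-- w ∈ B⁺(v). Any directed path in (V,B) on n vertices has < n arcs,
-- so fuel n gives exactly reachability.
reach : ∀ {n} → Branching n → Fin n → Fin n → Bool
reach {n} B = reachWithin B n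

-- The B-split M^B: rows indexed by U(B) (via positions in the list U M B)
split : ∀ {m n} (M : Mat m n) (B : Branching n) → Mat (length (U M B)) n
split M B l j = reach B (proj₂ (lookup (U M B) l)) j

splitRow : ∀ {m n} (M : Mat m n) (B : Branching n) → Fin (length (U M B)) → Fin m
splitRow M B l = proj₁ (lookup (U M B) l)

distinctRows : ∀ {k n} → Mat k n → ℕ
distinctRows {k} {n} N =
  length (deduplicate (VecP.≡-dec BoolP._≟_) (map (λ l → tabulate (N l)) (allFin k)))

module Submission where

-- Along an arc of B the support strictly grows, so (V, B) has no cycles, and out-degree ≤ 1 makes
-- everything reachable from v lie on the one path leaving v: each B⁺(v) is a chain. If columns i, j
-- share a row B⁺(v) of M^B they are comparable, say i ↝ j, and then every row containing i contains j,
-- which rules out a conflict. An entry M r j = 1 is produced by the uncovered pair reached by following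
-- covering arcs backwards from (r, j), while supports only grow along B, so r is the OR of the rows
-- U_B(r). Finally ↝ is antisymmetric, so the row B⁺(v) determines v and distinct rows correspond to I(B).

open import Defs
open import Data.Bool using (Bool; true; false; _∨_)
import Data.Bool.Properties as BoolP
open import Data.Nat using (ℕ; zero; suc; _+_; z≤n; s≤s; s≤s⁻¹; _<?_) renaming (_≤_ to _≤ℕ_; _<_ to _<ℕ_)
open import Data.Nat.Properties
  using (≤-total; ≮⇒≥; m≤n⇒∃[o]m+o≡n; m+n≡0⇒m≡0; +-identityʳ; <-irrefl; <⇒≢; <⇒≤)
open import Data.Fin using (Fin; toℕ; _≟_)
open import Data.Fin.Properties using (pigeonhole; toℕ<n; any?)
open import Data.Maybe using (Maybe; just; nothing; _>>=_; fromMaybe)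
open import Data.Maybe.Properties using (just-injective)
open import Data.Product using (∃; _×_; _,_; proj₁; proj₂)
open import Data.Sum using (_⊎_; inj₁; inj₂)
open import Data.Empty using (⊥-elim)
open import Data.List using (List; length; lookup; map; allFin; deduplicate; cartesianProduct)
open import Data.List.Properties using (length-map)
open import Data.List.Membership.Propositional using (_∈_)
open import Data.List.Membership.Propositional.Properties
  using (∈-lookup; ∈-filter⁻; ∈-filter⁺; ∈-cartesianProduct⁺; ∈-allFin; ∈-map⁺; ∈-map⁻; deduplicate-∈⇔)
open import Data.List.Membership.Propositional.Properties.WithK using (unique∧set⇒bag)
open import Data.List.Relation.Binary.BagAndSetEquality using (∼bag⇒↭)
open import Data.List.Relation.Binary.Permutation.Propositional.Properties using (↭-length)
open import Data.List.Relation.Unary.Any using (index)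
open import Data.List.Relation.Unary.Any.Properties using (lookup-index)
open import Data.List.Relation.Unary.Unique.Propositional using (Unique)
import Data.List.Relation.Unary.Unique.Propositional.Properties as Unique
import Data.List.Relation.Unary.Unique.DecPropositional.Properties as DecUnique
open import Data.Vec using (Vec; tabulate)
import Data.Vec as Vec
import Data.Vec.Properties as Vecₚ
open import Function using (_∘_)
open import Function.Bundles using (_⇔_; mk⇔; Equivalence)
open import Relation.Nullary using (yes; no)
open import Relation.Nullary.Decidable using (⌊_⌋)
open import Relation.Binary.PropositionalEquality
  using (_≡_; _≢_; refl; sym; trans; cong; subst; module ≡-Reasoning)

true≢false : true ≢ false
true≢false ()

≟-refl : ∀ {n} (v : Fin n) → ⌊ v ≟ v ⌋ ≡ true
≟-refl v with v ≟ v
... | yes _  = refl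
... | no v≢v = ⊥-elim (v≢v refl)

module Walks {n} (B : Branching n) where

  walk : ℕ → Fin n → Maybe (Fin n)
  walk zero    v = just v
  walk (suc k) v = B v >>= walk k

  _↝_ : Fin n → Fin n → Set
  v ↝ w = ∃ λ k → walk k v ≡ just w

  walk-split : ∀ a b {v w} → walk (a + b) v ≡ just w →
               ∃ λ x → walk a v ≡ just x × walk b x ≡ just w
  walk-split zero    b {v} e = v , refl , e
  walk-split (suc a) b {v} e with B v
  ... | just u = walk-split a b e

  walk-join : ∀ a b {v x w} → walk a v ≡ just x → walk b x ≡ just w → walk (a + b) v ≡ just w
  walk-join zero    b refl e = e
  walk-join (suc a) b {v} ex e with B v
  ... | just u = walk-join a b ex e

  walk-prefix : ∀ {a k v w} → a ≤ℕ k → walk k v ≡ just w → ∃ λ x → walk a v ≡ just x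
  walk-prefix {a} a≤k e
    with d , refl ← m≤n⇒∃[o]m+o≡n a≤k
    with x , ex , _ ← walk-split a d e = x , ex

  walk-later : ∀ {a b v i j} → a ≤ℕ b → walk a v ≡ just i → walk b v ≡ just j → i ↝ j
  walk-later {a} a≤b ea eb
    with d , refl ← m≤n⇒∃[o]m+o≡n a≤b
    with x , ex , exj ← walk-split a d eb
    with refl ← just-injective (trans (sym ex) ea) = d , exj

  ↝-refl : ∀ {v} → v ↝ v
  ↝-refl = 0 , refl

  ↝-trans : ∀ {u v w} → u ↝ v → v ↝ w → u ↝ w
  ↝-trans (a , ea) (b , eb) = a + b , walk-join a b ea eb

  ↝-total : ∀ {v i j} → v ↝ i → v ↝ j → i ↝ j ⊎ j ↝ i
  ↝-total (a , ea) (b , eb) with ≤-total a b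
  ... | inj₁ a≤b = inj₁ (walk-later a≤b ea eb)
  ... | inj₂ b≤a = inj₂ (walk-later b≤a eb ea)

  reachWithin-sound : ∀ f v w → reachWithin B f v w ≡ true → ∃ λ k → k ≤ℕ f × walk k v ≡ just w
  reachWithin-sound zero v w e with v ≟ w
  ... | yes refl = 0 , z≤n , refl
  reachWithin-sound (suc f) v w e with B v in eqB
  ... | nothing with v ≟ w
  ...   | yes refl = 0 , z≤n , refl
  reachWithin-sound (suc f) v w e | just u with v ≟ w
  ...   | yes refl = 0 , z≤n , refl
  ...   | no _ with k , k≤f , ek ← reachWithin-sound f u w e =
    suc k , s≤s k≤f , trans (cong (_>>= walk k) eqB) ek

  reachWithin-refl : ∀ f v → reachWithin B f v v ≡ true
  reachWithin-refl zero    v = ≟-refl v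
  reachWithin-refl (suc f) v with B v
  ... | nothing = ≟-refl v
  ... | just u  = cong (_∨ reachWithin B f u v) (≟-refl v)

  reachWithin-complete : ∀ k f v w → k ≤ℕ f → walk k v ≡ just w → reachWithin B f v w ≡ true
  reachWithin-complete zero f v .v _ refl = reachWithin-refl f v
  reachWithin-complete (suc k) (suc f) v w (s≤s k≤f) e with B v
  ... | just u = trans (cong (⌊ v ≟ w ⌋ ∨_) (reachWithin-complete k f u w k≤f e)) (BoolP.∨-zeroʳ _)

  Acyclic : Set
  Acyclic = ∀ k v → walk (suc k) v ≢ just v

  module _ (acyclic : Acyclic) where

    no-return : ∀ d v → walk d v ≡ just v → d ≡ 0
    no-return zero    v e = refl
    no-return (suc d) v e = ⊥-elim (acyclic d v e)

    walk-injective-≤ : ∀ {i j v w} → i ≤ℕ j → walk i v ≡ just w → walk j v ≡ just w → i ≡ j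
    walk-injective-≤ {i} i≤j ei ej
      with d , refl ← m≤n⇒∃[o]m+o≡n i≤j
      with x , ex , exw ← walk-split i d ej
      with refl ← just-injective (trans (sym ex) ei)
      with refl ← no-return d x exw = sym (+-identityʳ i)

    walk-injective : ∀ {i j v w} → walk i v ≡ just w → walk j v ≡ just w → i ≡ j
    walk-injective {i} {j} ei ej with ≤-total i j
    ... | inj₁ i≤j = walk-injective-≤ i≤j ei ej
    ... | inj₂ j≤i = sym (walk-injective-≤ j≤i ej ei)

    -- By pigeonhole, a walk of length ≥ n visits some vertex twice.
    walk-length< : ∀ {k v w} → walk k v ≡ just w → k <ℕ n
    walk-length< {k} {v} e with k <? n
    ... | yes k<n = k<n
    ... | no k≮n
      with i , j , i<j , same ← pigeonhole (s≤s (≮⇒≥ k≮n)) (λ i → fromMaybe v (walk (toℕ i) v)) =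
      ⊥-elim (<⇒≢ i<j (walk-injective ei (subst (λ y → walk (toℕ j) v ≡ just y) (sym same′) ej)))
      where
      prefix : ∀ (i : Fin (suc k)) → ∃ λ x → walk (toℕ i) v ≡ just x
      prefix i = walk-prefix (s≤s⁻¹ (toℕ<n i)) e
      ei = proj₂ (prefix i)
      ej = proj₂ (prefix j)
      same′ : proj₁ (prefix i) ≡ proj₁ (prefix j)
      same′ = trans (sym (cong (fromMaybe v) ei)) (trans same (cong (fromMaybe v) ej))

    reach⇒↝ : ∀ {v w} → reach B v w ≡ true → v ↝ w
    reach⇒↝ {v} {w} e with k , _ , ek ← reachWithin-sound n v w e = k , ek

    ↝⇒reach : ∀ {v w} → v ↝ w → reach B v w ≡ true
    ↝⇒reach {v} {w} (k , ek) = reachWithin-complete k n v w (<⇒≤ (walk-length< ek)) ek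

    ↝-antisym : ∀ {v w} → v ↝ w → w ↝ v → v ≡ w
    ↝-antisym (a , ea) (b , eb) with refl ← m+n≡0⇒m≡0 a (no-return (a + b) _ (walk-join a b ea eb)) =
      just-injective ea

    reachRows : ∀ {k} → (Fin k → Fin n) → Mat k n
    reachRows vs l = reach B (vs l)

    reachRows-conflictFree : ∀ {k} (vs : Fin k → Fin n) → ConflictFree (reachRows vs)
    reachRows-conflictFree vs i j l l′ l″ _ _ _ ((li , lj) , (l′i , l′j) , (l″i , l″j))
      with ↝-total (reach⇒↝ li) (reach⇒↝ lj)
    ... | inj₁ i↝j = true≢false (trans (sym (↝⇒reach (↝-trans (reach⇒↝ l′i) i↝j))) l′j)
    ... | inj₂ j↝i = true≢false (trans (sym (↝⇒reach (↝-trans (reach⇒↝ l″j) j↝i))) l″i)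

    reachRow : Fin n → Vec Bool n
    reachRow v = tabulate (reach B v)

    reachRow-≡⇒↝ : ∀ {v w} → reachRow v ≡ reachRow w → v ↝ w
    reachRow-≡⇒↝ {v} {w} e = reach⇒↝ (begin
      reach B v w                  ≡⟨ Vecₚ.lookup∘tabulate (reach B v) w ⟨
      Vec.lookup (reachRow v) w    ≡⟨ cong (λ row → Vec.lookup row w) e ⟩
      Vec.lookup (reachRow w) w    ≡⟨ Vecₚ.lookup∘tabulate (reach B w) w ⟩
      reach B w w                  ≡⟨ ↝⇒reach ↝-refl ⟩
      true                         ∎)
      where open ≡-Reasoning

    reachRow-injective : ∀ {v w} → reachRow v ≡ reachRow w → v ≡ w
    reachRow-injective e = ↝-antisym (reachRow-≡⇒↝ e) (reachRow-≡⇒↝ (sym e))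

    reachRows-distinctRows : ∀ {k} (vs : Fin k → Fin n) (ws : List (Fin n)) → Unique ws →
      (∀ {v} → v ∈ ws ⇔ ∃ λ l → vs l ≡ v) → distinctRows (reachRows vs) ≡ length ws
    reachRows-distinctRows {k} vs ws ws-unique ws-image = begin
      length (deduplicate ≡-dec rows)
        ≡⟨ ↭-length (∼bag⇒↭ (unique∧set⇒bag rows-unique ws-rows-unique sameRows)) ⟩
      length (map reachRow ws)         ≡⟨ length-map reachRow ws ⟩
      length ws                        ∎
      where
      open ≡-Reasoning
      ≡-dec = Vecₚ.≡-dec BoolP._≟_
      rows = map (reachRow ∘ vs) (allFin k)
      rows-unique = DecUnique.deduplicate-! ≡-dec rows
      ws-rows-unique = Unique.map⁺ reachRow-injective ws-unique
      sameRows : ∀ {row} → row ∈ deduplicate ≡-dec rows ⇔ row ∈ map reachRow ws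
      sameRows = mk⇔
        (λ h → let l , _ , eq = ∈-map⁻ (reachRow ∘ vs) (Equivalence.from (deduplicate-∈⇔ ≡-dec) h)
               in subst (_∈ map reachRow ws) (sym eq)
                    (∈-map⁺ reachRow (Equivalence.from ws-image (l , refl))))
        (λ h → let v , v∈ws , eq = ∈-map⁻ reachRow h
                   l , vl≡v = Equivalence.to ws-image v∈ws
               in Equivalence.to (deduplicate-∈⇔ ≡-dec)
                    (subst (_∈ rows) (trans (cong reachRow vl≡v) (sym eq))
                      (∈-map⁺ (reachRow ∘ vs) (∈-allFin l))))

module _ {m n} (M : Mat m n) (B : Branching n) (isB : IsBranching M B) where
  open Walks B

  ↝-⊆ : ∀ {v w r} → v ↝ w → M r v ≡ true → M r w ≡ true
  ↝-⊆ (k , e) = walk-⊆ k e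
    where
    walk-⊆ : ∀ k {v w r} → walk k v ≡ just w → M r v ≡ true → M r w ≡ true
    walk-⊆ zero    refl h = h
    walk-⊆ (suc k) {v} e h with B v in eq
    ... | just u = walk-⊆ k e (proj₁ (isB v u eq) _ h)

  branching-acyclic : Acyclic
  branching-acyclic k v e with B v in eq
  ... | just u with r , r∈u , r∉v ← proj₂ (isB v u eq) =
    true≢false (trans (sym (↝-⊆ (k , e) r∈u)) r∉v)

  -- Follow covering arcs backwards from j for s steps, unless an uncovered pair is met first.
  descend : ∀ s {r j} → M r j ≡ true →
    (∃ λ v → Uncov M B (r , v) × v ↝ j) ⊎ (∃ λ v → M r v ≡ true × walk s v ≡ just j)
  descend zero    {j = j} h = inj₂ (j , h , refl)
  descend (suc s) {r} h with descend s h
  ... | inj₁ found = inj₁ found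
  ... | inj₂ (v , r∈v , ev) with covered? M B r v
  ...   | no r∉cov = inj₁ (v , (r∈v , r∉cov) , s , ev)
  ...   | yes (u , Bu≡v , r∈u) = inj₂ (u , r∈u , trans (cong (_>>= walk s) Bu≡v) ev)

  uncovered-source : ∀ {r j} → M r j ≡ true → ∃ λ v → Uncov M B (r , v) × v ↝ j
  uncovered-source h with descend n h
  ... | inj₁ found = found
  ... | inj₂ (_ , _ , e) = ⊥-elim (<-irrefl refl (walk-length< branching-acyclic e))

  U-complete : ∀ {p} → Uncov M B p → ∃ λ l → lookup (U M B) l ≡ p
  U-complete {r , j} u = index p∈U , sym (lookup-index p∈U)
    where p∈U = ∈-filter⁺ (uncov? M B) (∈-cartesianProduct⁺ (∈-allFin r) (∈-allFin j)) u

  U-sound : ∀ l → Uncov M B (lookup (U M B) l)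
  U-sound l = proj₂ (∈-filter⁻ (uncov? M B) {xs = cartesianProduct (allFin m) (allFin n)} (∈-lookup l))

  split-rowSplit : IsRowSplitVia M (split M B) (splitRow M B)
  split-rowSplit r j = mk⇔ to from
    where
    to : M r j ≡ true → ∃ λ l → splitRow M B l ≡ r × split M B l j ≡ true
    to h with v , u , v↝j ← uncovered-source h with l , eq ← U-complete u =
      l , cong proj₁ eq ,
      subst (λ p → reach B (proj₂ p) j ≡ true) (sym eq) (↝⇒reach branching-acyclic v↝j)
    from : (∃ λ l → splitRow M B l ≡ r × split M B l j ≡ true) → M r j ≡ true
    from (l , refl , h) = ↝-⊆ (reach⇒↝ branching-acyclic h) (proj₁ (U-sound l))

  split-conflictFree : ConflictFree (split M B)
  split-conflictFree = reachRows-conflictFree branching-acyclic (proj₂ ∘ lookup (U M B))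

  I-image : ∀ {v} → v ∈ I M B ⇔ ∃ λ l → proj₂ (lookup (U M B) l) ≡ v
  I-image = mk⇔
    (λ h → let _ , u = proj₂ (∈-filter⁻ contains-uncovered? {xs = allFin n} h)
               l , eq = U-complete u
           in l , cong proj₂ eq)
    (λ where (l , refl) → ∈-filter⁺ contains-uncovered? (∈-allFin _) (_ , U-sound l))
    where contains-uncovered? = λ j → any? λ r → uncov? M B (r , j)

  split-distinctRows : distinctRows (split M B) ≡ length (I M B)
  split-distinctRows = reachRows-distinctRows branching-acyclic (proj₂ ∘ lookup (U M B)) (I M B)
    (Unique.filter⁺ _ (Unique.allFin⁺ n)) I-image

-- Zero rows and duplicated columns do no harm once the vertices of D_M are column indices.
lemma1 : ∀ {m n} (M : Mat m n) (B : Branching n) →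
    NoZeroRows M → NoDupCols M → IsBranching M B →
    ConflictFree (split M B) ×
    IsRowSplitVia M (split M B) (splitRow M B) ×
    distinctRows (split M B) ≡ length (I M B)
lemma1 M B _ _ isB = split-conflictFree M B isB , split-rowSplit M B isB , split-distinctRows M B isB
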